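{- Let $\beta=\frac{1+\sqrt5}{2}$. For every nonnegative integer $n$ with Zeckendorf expansion $n=\sum_{j\ge0}\epsilon_jF_{j+2}$, let $\delta(n)=\frac1{\sqrt5}\sum_{j\ge0}\epsilon_j\beta^{j+2}$ and let $e(n)=\epsilon_0$ be the last digit of the expansion. Then $$\delta(n+1)-\delta(n)=\begin{cases}\frac{1}{\sqrt5}\beta^2 & \text{if } e(n)=0,\\ \frac1{\sqrt5}\beta & \text{if } e(n)=1.\end{cases}$$ Consequently, $(\delta(n))_{n\ge0}$ is an unbounded increasing sequence.
   Context: Fibonacci numbers: $F_0=0,F_1=1,F_n=F_{n-1}+F_{n-2}$. Zeckendorf expansion: every nonnegative integer $n$ is uniquely $n=\sum_{j\ge0}\epsilon_jF_{j+2}$ with $\epsilon_j\in\{0,1\}$, finitely many nonzero, $\epsilon_j\epsilon_{j+1}=0$ (for $n=0$ all $\epsilon_j=0$). -}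

module Defs where

open import Data.Nat using (ℕ; zero; suc)
import Data.Nat as ℕ
open import Data.Bool using (Bool; true; false; if_then_else_)
open import Data.List using (List; []; _∷_)
open import Data.Integer using (+_)
open import Data.Rational as ℚ using (ℚ; 0ℚ; _/_)
open import Data.Product using (_×_; _,_)
open import Data.Sum using (_⊎_)
open import Data.Empty using (⊥)
open import Data.Unit using (⊤)
open import Relation.Binary.PropositionalEquality using (_≡_)
open import Relation.Nullary using (¬_)

fib : ℕ → ℕ
fib zero = 0
fib (suc zero) = 1
fib (suc (suc n)) = fib (suc n) ℕ.+ fib n

-- A digit list ε = (ε_0, ε_1, ...) (least significant first).
-- Value Σ_j ε_j F_{j+2}; zvalFrom k gives the value with the head at index k.
zvalFrom : ℕ → List Bool → ℕ
zvalFrom k [] = 0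
zvalFrom k (b ∷ bs) = (if b then fib (k ℕ.+ 2) else 0) ℕ.+ zvalFrom (suc k) bs

zval : List Bool → ℕ
zval = zvalFrom 0

NoAdj : List Bool → Set
NoAdj [] = ⊤
NoAdj (b ∷ []) = ⊤
NoAdj (true ∷ true ∷ bs) = ⊥
NoAdj (true ∷ false ∷ bs) = NoAdj (false ∷ bs)
NoAdj (false ∷ b ∷ bs) = NoAdj (b ∷ bs)

IsZeck : List Bool → ℕ → Set
IsZeck ε n = (zval ε ≡ n) × NoAdj ε

-- last digit e(n) = ε_0 (0 for the empty expansion of n = 0)
lastDigit : List Bool → Bool
lastDigit [] = false
lastDigit (b ∷ _) = b

-- The real quadratic field ℚ(√5): the pair (a , b) stands for a + b√5.
Q5 : Set
Q5 = ℚ × ℚ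

infixl 6 _+₅_ _-₅_
infixl 7 _*₅_
infix 4 _<₅_

_+₅_ : Q5 → Q5 → Q5
(a , b) +₅ (c , d) = (a ℚ.+ c , b ℚ.+ d)

_-₅_ : Q5 → Q5 → Q5
(a , b) -₅ (c , d) = (a ℚ.- c , b ℚ.- d)

_*₅_ : Q5 → Q5 → Q5
(a , b) *₅ (c , d) = (a ℚ.* c ℚ.+ (+ 5 / 1) ℚ.* (b ℚ.* d) , a ℚ.* d ℚ.+ b ℚ.* c)

0₅ : Q5
0₅ = (0ℚ , 0ℚ)

1₅ : Q5
1₅ = (+ 1 / 1 , 0ℚ)

_^₅_ : Q5 → ℕ → Q5
x ^₅ zero = 1₅
x ^₅ suc n = x *₅ (x ^₅ n)

β : Q5
β = (+ 1 / 2 , + 1 / 2)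

-- 1/√5 = √5/5
invSqrt5 : Q5
invSqrt5 = (0ℚ , + 1 / 5)

-- positivity of a + b√5 as a real number (real order restricted to ℚ(√5))
Pos₅ : Q5 → Set
Pos₅ (a , b) =
  (0ℚ ℚ.≤ a × 0ℚ ℚ.≤ b × ¬ (a ≡ 0ℚ × b ≡ 0ℚ))
  ⊎ ((0ℚ ℚ.< a × b ℚ.< 0ℚ × (+ 5 / 1) ℚ.* (b ℚ.* b) ℚ.< a ℚ.* a)
  ⊎ (a ℚ.< 0ℚ × 0ℚ ℚ.< b × a ℚ.* a ℚ.< (+ 5 / 1) ℚ.* (b ℚ.* b)))

_<₅_ : Q5 → Q5 → Set
x <₅ y = Pos₅ (y -₅ x)

deltaFrom : ℕ → List Bool → Q5
deltaFrom k [] = 0₅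
deltaFrom k (b ∷ bs) =
  (if b then invSqrt5 *₅ (β ^₅ (k ℕ.+ 2)) else 0₅) +₅ deltaFrom (suc k) bs

δ : List Bool → Q5
δ = deltaFrom 0

{-# OPTIONS --safe #-}
module Submission where

-- For a digit list ε put N = Σ ε_j F_{j+2} and M = Σ ε_j F_{j+1}. Since β^{j+2} = F_{j+2} β + F_{j+1},
-- √5 δ = Nβ + M. For every 0-1 list, adjacent ones allowed, M = ⌊(N + 1)/β⌋: this is a pair of
-- quadratic inequalities over ℕ, and they survive prepending a digit e, which maps Nβ + M to
-- β(Nβ + M) + eβ². Passing from n to n + 1 raises N by 1, and M by 1 or 0 according as the last
-- Zeckendorf digit of n is 0 or 1, as the explicit expansions 1ε′ resp. 01ε″ of n + 1 show; since
-- β + 1 = β² this is the claimed increment. For unboundedness, the expansion with a single one at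
-- position k has δ = β^{k+2}/√5.

open import Defs
open import Algebra.Properties.CommutativeSemigroup using (interchange)
open import Data.Bool using (Bool; true; false; if_then_else_)
open import Data.Empty using (⊥-elim)
open import Data.Integer as ℤ using (+_; -[1+_]; +≤+; +<+; -<+)
import Data.Integer.Properties as ℤ
open import Data.Integer.Solver using () renaming (module +-*-Solver to ℤ-Solver)
open import Data.List using (List; []; _∷_)
open import Data.Nat using (ℕ; zero; suc; _+_; _*_; _≤_; _<_; z≤n; s≤s; _≤?_)
import Data.Nat.Coprimality as Coprime
open import Data.Nat.Properties
open import Data.Nat.Solver using () renaming (module +-*-Solver to ℕ-Solver)
open import Data.Product using (_×_; _,_; proj₁; proj₂; ∃; ∃-syntax)
open import Data.Rational as ℚ using (ℚ; mkℚ; 0ℚ; ½; _/_; _⊔_; *<*; *≤*)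
import Data.Rational.Properties as ℚ
open import Data.Rational.Solver using () renaming (module +-*-Solver to ℚ-Solver)
open import Data.Rational.Unnormalised.Base using (*≡*)
import Data.Rational.Unnormalised.Properties as ℚᵘ
open import Data.Sum using (inj₁)
open import Data.Unit using (tt)
open import Relation.Binary.Definitions using (tri<; tri≈; tri>)
open import Relation.Binary.PropositionalEquality
open import Relation.Nullary using (yes; no)
open import Relation.Nullary.Decidable using (toWitness)

fibSum : ℕ → List Bool → ℕ
fibSum k [] = 0
fibSum k (b ∷ ε) = (if b then fib k else 0) + fibSum (suc k) ε

zvalFrom≡fibSum : ∀ k ε → zvalFrom k ε ≡ fibSum (2 + k) ε
zvalFrom≡fibSum k [] = refl
zvalFrom≡fibSum k (false ∷ ε) = zvalFrom≡fibSum (suc k) ε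
zvalFrom≡fibSum k (true ∷ ε) = cong₂ _+_ (cong fib (+-comm k 2)) (zvalFrom≡fibSum (suc k) ε)

fibSum-rec : ∀ k ε → fibSum (2 + k) ε ≡ fibSum (1 + k) ε + fibSum k ε
fibSum-rec k [] = refl
fibSum-rec k (false ∷ ε) = fibSum-rec (suc k) ε
fibSum-rec k (true ∷ ε) = begin
  fib (2 + k) + fibSum (3 + k) ε
    ≡⟨ cong (_+_ (fib (2 + k))) (fibSum-rec (suc k) ε) ⟩
  (fib (1 + k) + fib k) + (fibSum (2 + k) ε + fibSum (1 + k) ε)
    ≡⟨ interchange +-commutativeSemigroup (fib (1 + k)) (fib k) (fibSum (2 + k) ε) (fibSum (1 + k) ε) ⟩
  (fib (1 + k) + fibSum (2 + k) ε) + (fib k + fibSum (1 + k) ε) ∎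
  where open ≡-Reasoning

infix 4 _<_/β _/β<_

-- 1/β is the positive root of x² + x − 1, so m < n/β iff n m + m² < n².
_<_/β : ℕ → ℕ → Set
m < n /β = n * m + m * m < n * n

_/β<_ : ℕ → ℕ → Set
n /β< m = n * n < n * m + m * m

-- m = ⌊x/β⌋ when x > 0; both inequalities are strict since x/β is then irrational.
IsFloor/β : ℕ → ℕ → Set
IsFloor/β x m = m < x /β × x /β< suc m

square-split : ∀ n m → (n + m) * (n + m) ≡ (n * m + m * m) + (n * n + n * m)
square-split = solve 2 (λ n m → (n :+ m) :* (n :+ m) := (n :* m :+ m :* m) :+ (n :* n :+ n :* m)) refl
  where open ℕ-Solver

shifted-split : ∀ n m → (n + m) * n + n * n ≡ n * n + (n * n + n * m)
shifted-split = solve 2 (λ n m → (n :+ m) :* n :+ n :* n := n :* n :+ (n :* n :+ n :* m)) refl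
  where open ℕ-Solver

suc-square : ∀ n → suc n * suc n ≡ n * n + suc (n + n)
suc-square = solve 1 (λ n → (con 1 :+ n) :* (con 1 :+ n) := n :* n :+ (con 1 :+ (n :+ n))) refl
  where open ℕ-Solver

suc-mixed : ∀ n m → suc n * m + m * m ≡ (n * m + m * m) + m
suc-mixed = solve 2 (λ n m → (con 1 :+ n) :* m :+ m :* m := (n :* m :+ m :* m) :+ m) refl
  where open ℕ-Solver

<⇒/β< : ∀ n m → n < m → n /β< m
<⇒/β< n m n<m = <-≤-trans (*-mono-< n<m n<m) (m≤n+m (m * m) (n * m))

-- Multiplying nβ + m by β gives (n + m)β + n; these two lemmas are its effect on the inequalities.
/β<⇒<+/β : ∀ n m → n /β< m → n < (n + m) /β
/β<⇒<+/β n m h = begin-strict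
  (n + m) * n + n * n                ≡⟨ shifted-split n m ⟩
  n * n + (n * n + n * m)            <⟨ +-monoˡ-< (n * n + n * m) h ⟩
  (n * m + m * m) + (n * n + n * m)  ≡⟨ square-split n m ⟨
  (n + m) * (n + m)                  ∎
  where open ≤-Reasoning

<-/β⇒+/β< : ∀ n m → m < n /β → (n + m) /β< n
<-/β⇒+/β< n m h = begin-strict
  (n + m) * (n + m)                  ≡⟨ square-split n m ⟩
  (n * m + m * m) + (n * n + n * m)  <⟨ +-monoˡ-< (n * n + n * m) h ⟩
  n * n + (n * n + n * m)            ≡⟨ shifted-split n m ⟨
  (n + m) * n + n * n                ∎
  where open ≤-Reasoning

≤-<-/β-trans : ∀ {k m} n → k ≤ m → m < n /β → k < n /β
≤-<-/β-trans n k≤m = ≤-<-trans (+-mono-≤ (*-monoʳ-≤ n k≤m) (*-mono-≤ k≤m k≤m))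

<-/β⇒≤ : ∀ m n → m < n /β → m ≤ n
<-/β⇒≤ m n h with m ≤? n
... | yes m≤n = m≤n
... | no m≰n = ⊥-elim (<-asym h (<⇒/β< n m (≰⇒> m≰n)))

<-/β⇒<-suc/β : ∀ m n → m < n /β → m < suc n /β
<-/β⇒<-suc/β m n h = begin-strict
  suc n * m + m * m        ≡⟨ suc-mixed n m ⟩
  (n * m + m * m) + m      <⟨ +-mono-<-≤ h (≤-trans (<-/β⇒≤ m n h) (≤-trans (m≤m+n n n) (n≤1+n (n + n)))) ⟩
  n * n + suc (n + n)      ≡⟨ suc-square n ⟨
  suc n * suc n            ∎
  where open ≤-Reasoning

suc/β<⇒/β< : ∀ n m → suc n /β< m → n /β< m
suc/β<⇒/β< n m h with m ≤? suc (n + n)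
... | no m≰2n+1 = <⇒/β< n m (≤-<-trans (≤-trans (m≤m+n n n) (n≤1+n (n + n))) (≰⇒> m≰2n+1))
... | yes m≤2n+1 = +-cancelʳ-< (suc (n + n)) (n * n) (n * m + m * m) (begin-strict
  n * n + suc (n + n)                ≡⟨ suc-square n ⟨
  suc n * suc n                      <⟨ h ⟩
  suc n * m + m * m                  ≡⟨ suc-mixed n m ⟩
  (n * m + m * m) + m                ≤⟨ +-monoʳ-≤ (n * m + m * m) m≤2n+1 ⟩
  (n * m + m * m) + suc (n + n)      ∎)
  where open ≤-Reasoning

isFloor/β-unique : ∀ {x m m′} → IsFloor/β x m → IsFloor/β x m′ → m ≡ m′
isFloor/β-unique {x} {m} {m′} (m<x/β , x/β<1+m) (m′<x/β , x/β<1+m′) with <-cmp m m′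
... | tri≈ _ m≡m′ _ = m≡m′
... | tri< m<m′ _ _ = ⊥-elim (<-asym (≤-<-/β-trans x m<m′ m′<x/β) x/β<1+m)
... | tri> _ _ m′<m = ⊥-elim (<-asym (≤-<-/β-trans x m′<m m<x/β) x/β<1+m′)

-- Prepending a digit 0 resp. 1 to a list with (fibSum 2, fibSum 1) = (n, m) gives (n + m, n) resp. (n + m + 1, n + 1).
isFloor/β-step₀ : ∀ n m → IsFloor/β (suc n) m → IsFloor/β (suc (n + m)) n
isFloor/β-step₀ n m (m<x/β , x/β<1+m) =
    subst (λ x → n < x /β) (+-suc n m) (/β<⇒<+/β n (suc m) (suc/β<⇒/β< n (suc m) x/β<1+m))
  , <-/β⇒+/β< (suc n) m m<x/β

isFloor/β-step₁ : ∀ n m → IsFloor/β (suc n) m → IsFloor/β (suc (suc (n + m))) (suc n)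
isFloor/β-step₁ n m (m<x/β , x/β<1+m) =
    subst (λ x → suc n < x /β) (cong suc (+-suc n m)) (/β<⇒<+/β (suc n) (suc m) x/β<1+m)
  , <-/β⇒+/β< (suc (suc n)) m (<-/β⇒<-suc/β m (suc n) m<x/β)

isFloor/β-fibSum : ∀ ε → IsFloor/β (suc (fibSum 2 ε)) (fibSum 1 ε)
isFloor/β-fibSum [] = s≤s z≤n , s≤s (s≤s z≤n)
isFloor/β-fibSum (false ∷ ε) rewrite fibSum-rec 1 ε =
  isFloor/β-step₀ (fibSum 2 ε) (fibSum 1 ε) (isFloor/β-fibSum ε)
isFloor/β-fibSum (true ∷ ε) rewrite fibSum-rec 1 ε =
  isFloor/β-step₁ (fibSum 2 ε) (fibSum 1 ε) (isFloor/β-fibSum ε)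

-- The list for n + 1 below need not be a Zeckendorf expansion, which isFloor/β-fibSum does not require.
isFloor/β-succ-last0 : ∀ ε → lastDigit ε ≡ false → IsFloor/β (2 + fibSum 2 ε) (suc (fibSum 1 ε))
isFloor/β-succ-last0 [] _ = isFloor/β-fibSum (true ∷ [])
isFloor/β-succ-last0 (false ∷ ε) _ = isFloor/β-fibSum (true ∷ ε)

isFloor/β-succ-last1 : ∀ ε → NoAdj ε → lastDigit ε ≡ true → IsFloor/β (2 + fibSum 2 ε) (fibSum 1 ε)
isFloor/β-succ-last1 (true ∷ []) _ _ = isFloor/β-fibSum (false ∷ true ∷ [])
isFloor/β-succ-last1 (true ∷ false ∷ ε) _ _ = isFloor/β-fibSum (false ∷ true ∷ ε)

fromℕ : ℕ → ℚ
fromℕ n = mkℚ (+ n) 0 (Coprime.sym (Coprime.1-coprimeTo n))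

fromℕ-+ : ∀ m n → fromℕ (m + n) ≡ fromℕ m ℚ.+ fromℕ n
fromℕ-+ m n = ℚ.toℚᵘ-injective
  (ℚᵘ.≃-sym (ℚᵘ.≃-trans (ℚ.toℚᵘ-homo-+ (fromℕ m) (fromℕ n)) (*≡* cross-multiplied)))
  where
  open ℤ-Solver
  cross-multiplied : (+ m ℤ.* + 1 ℤ.+ + n ℤ.* + 1) ℤ.* + 1 ≡ + (m + n) ℤ.* (+ 1 ℤ.* + 1)
  cross-multiplied = solve 2 (λ x y → (x :* con (+ 1) :+ y :* con (+ 1)) :* con (+ 1)
    := (x :+ y) :* (con (+ 1) :* con (+ 1))) refl (+ m) (+ n)

fromℕ-mono-≤ : ∀ {m n} → m ≤ n → fromℕ m ℚ.≤ fromℕ n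
fromℕ-mono-≤ {m} {n} m≤n =
  *≤* (subst₂ ℤ._≤_ (sym (ℤ.*-identityʳ (+ m))) (sym (ℤ.*-identityʳ (+ n))) (+≤+ m≤n))

archimedean : ∀ p → ∃ λ n → p ℚ.< fromℕ n
archimedean (mkℚ z d _) =
  suc ℤ.∣ z ∣ , *<* (subst (ℤ._< + suc ℤ.∣ z ∣ ℤ.* + suc d) (sym (ℤ.*-identityʳ z)) (z<[1+∣z∣]*[1+d] z))
  where
  z<[1+∣z∣]*[1+d] : ∀ z → z ℤ.< + suc ℤ.∣ z ∣ ℤ.* + suc d
  z<[1+∣z∣]*[1+d] (+ x) = +<+ (s≤s (≤-trans (m≤m*n x (suc d)) (m≤n+m _ d)))
  z<[1+∣z∣]*[1+d] -[1+ x ] = -<+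

+₅-identityˡ : ∀ x → 0₅ +₅ x ≡ x
+₅-identityˡ (a , b) = cong₂ _,_ (ℚ.+-identityˡ a) (ℚ.+-identityˡ b)

x+₅y-₅y≡x : ∀ x y → x +₅ y -₅ y ≡ x
x+₅y-₅y≡x (a , b) (c , d) = cong₂ _,_ (p+q-q≡p a c) (p+q-q≡p b d)
  where
  open ℚ-Solver
  p+q-q≡p : ∀ p q → p ℚ.+ q ℚ.- q ≡ p
  p+q-q≡p = solve 2 (λ p q → p :+ q :- q := p) refl

*₅-distribˡ-+₅ : ∀ x y z → x *₅ (y +₅ z) ≡ x *₅ y +₅ x *₅ z
*₅-distribˡ-+₅ (a , b) (c , d) (e , f) = cong₂ _,_
  (solve 6 (λ a b c d e f → a :* (c :+ e) :+ con (+ 5 / 1) :* (b :* (d :+ f))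
    := (a :* c :+ con (+ 5 / 1) :* (b :* d)) :+ (a :* e :+ con (+ 5 / 1) :* (b :* f))) refl a b c d e f)
  (solve 6 (λ a b c d e f → a :* (d :+ f) :+ b :* (c :+ e)
    := (a :* d :+ b :* c) :+ (a :* f :+ b :* e)) refl a b c d e f)
  where open ℚ-Solver

infix 5 _·β+_

_·β+_ : ℚ → ℚ → Q5
x ·β+ y = (y ℚ.+ x ℚ.* ½ , x ℚ.* ½)

·β+-+ : ∀ x y z w → (x ℚ.+ z) ·β+ (y ℚ.+ w) ≡ (x ·β+ y) +₅ (z ·β+ w)
·β+-+ x y z w = cong₂ _,_
  (solve 4 (λ x y z w → (y :+ w) :+ (x :+ z) :* con ½ := (y :+ x :* con ½) :+ (w :+ z :* con ½)) refl x y z w)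
  (solve 2 (λ x z → (x :+ z) :* con ½ := x :* con ½ :+ z :* con ½) refl x z)
  where open ℚ-Solver

β*₅·β+ : ∀ x y → β *₅ (x ·β+ y) ≡ (x ℚ.+ y) ·β+ x
β*₅·β+ x y = cong₂ _,_
  (solve 2 (λ x y → con ½ :* (y :+ x :* con ½) :+ con (+ 5 / 1) :* (con ½ :* (x :* con ½))
    := x :+ (x :+ y) :* con ½) refl x y)
  (solve 2 (λ x y → con ½ :* (x :* con ½) :+ con ½ :* (y :+ x :* con ½)
    := (x :+ y) :* con ½) refl x y)
  where open ℚ-Solver

β^suc≡fib·β+fib : ∀ j → β ^₅ suc j ≡ fromℕ (fib (suc j)) ·β+ fromℕ (fib j)
β^suc≡fib·β+fib zero = refl
β^suc≡fib·β+fib (suc j) = begin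
  β *₅ β ^₅ suc j                                               ≡⟨ cong (β *₅_) (β^suc≡fib·β+fib j) ⟩
  β *₅ (fromℕ (fib (suc j)) ·β+ fromℕ (fib j))                  ≡⟨ β*₅·β+ (fromℕ (fib (suc j))) (fromℕ (fib j)) ⟩
  (fromℕ (fib (suc j)) ℚ.+ fromℕ (fib j)) ·β+ fromℕ (fib (suc j))
    ≡⟨ cong (_·β+ fromℕ (fib (suc j))) (fromℕ-+ (fib (suc j)) (fib j)) ⟨
  fromℕ (fib (2 + j)) ·β+ fromℕ (fib (suc j))                    ∎
  where open ≡-Reasoning

deltaFrom≡fibSum : ∀ k ε → deltaFrom k ε ≡ invSqrt5 *₅ (fromℕ (fibSum (2 + k) ε) ·β+ fromℕ (fibSum (1 + k) ε))
deltaFrom≡fibSum k [] = refl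
deltaFrom≡fibSum k (false ∷ ε) = trans (+₅-identityˡ (deltaFrom (suc k) ε)) (deltaFrom≡fibSum (suc k) ε)
deltaFrom≡fibSum k (true ∷ ε) = begin
  invSqrt5 *₅ β ^₅ (k + 2) +₅ deltaFrom (suc k) ε
    ≡⟨ cong₂ (λ j x → invSqrt5 *₅ β ^₅ j +₅ x) (+-comm k 2) (deltaFrom≡fibSum (suc k) ε) ⟩
  invSqrt5 *₅ β ^₅ (2 + k) +₅ invSqrt5 *₅ (S₂ ·β+ S₁)
    ≡⟨ cong (λ x → invSqrt5 *₅ x +₅ invSqrt5 *₅ (S₂ ·β+ S₁)) (β^suc≡fib·β+fib (suc k)) ⟩
  invSqrt5 *₅ (F₂ ·β+ F₁) +₅ invSqrt5 *₅ (S₂ ·β+ S₁)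
    ≡⟨ *₅-distribˡ-+₅ invSqrt5 (F₂ ·β+ F₁) (S₂ ·β+ S₁) ⟨
  invSqrt5 *₅ ((F₂ ·β+ F₁) +₅ (S₂ ·β+ S₁))
    ≡⟨ cong (invSqrt5 *₅_) (·β+-+ F₂ F₁ S₂ S₁) ⟨
  invSqrt5 *₅ ((F₂ ℚ.+ S₂) ·β+ (F₁ ℚ.+ S₁))
    ≡⟨ cong₂ (λ x y → invSqrt5 *₅ (x ·β+ y)) (fromℕ-+ (fib (2 + k)) _) (fromℕ-+ (fib (1 + k)) _) ⟨
  invSqrt5 *₅ (fromℕ (fib (2 + k) + fibSum (3 + k) ε) ·β+ fromℕ (fib (1 + k) + fibSum (2 + k) ε)) ∎
  where
  open ≡-Reasoning
  F₂ F₁ S₂ S₁ : ℚ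
  F₂ = fromℕ (fib (2 + k))
  F₁ = fromℕ (fib (1 + k))
  S₂ = fromℕ (fibSum (3 + k) ε)
  S₁ = fromℕ (fibSum (2 + k) ε)

δ≡fibSum : ∀ ε → δ ε ≡ invSqrt5 *₅ (fromℕ (fibSum 2 ε) ·β+ fromℕ (fibSum 1 ε))
δ≡fibSum = deltaFrom≡fibSum 0

fibSum-succ : ∀ {n} ε ε′ → IsZeck ε n → IsZeck ε′ (suc n) → fibSum 2 ε′ ≡ suc (fibSum 2 ε)
fibSum-succ ε ε′ (refl , _) (zval≡1+n , _) =
  trans (sym (zvalFrom≡fibSum 0 ε′)) (trans zval≡1+n (cong suc (zvalFrom≡fibSum 0 ε)))

δ-increment : ∀ {n} ε ε′ d → IsZeck ε n → IsZeck ε′ (suc n) →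
  fibSum 1 ε′ ≡ d + fibSum 1 ε → δ ε′ -₅ δ ε ≡ invSqrt5 *₅ (fromℕ 1 ·β+ fromℕ d)
δ-increment ε ε′ d z z′ M′≡d+M = begin
  δ ε′ -₅ δ ε
    ≡⟨ cong₂ _-₅_ (δ≡fibSum ε′) (δ≡fibSum ε) ⟩
  invSqrt5 *₅ (fromℕ (fibSum 2 ε′) ·β+ fromℕ (fibSum 1 ε′)) -₅ δ₀
    ≡⟨ cong₂ (λ a b → invSqrt5 *₅ (fromℕ a ·β+ fromℕ b) -₅ δ₀) (fibSum-succ ε ε′ z z′) M′≡d+M ⟩
  invSqrt5 *₅ (fromℕ (1 + fibSum 2 ε) ·β+ fromℕ (d + fibSum 1 ε)) -₅ δ₀
    ≡⟨ cong₂ (λ a b → invSqrt5 *₅ (a ·β+ b) -₅ δ₀) (fromℕ-+ 1 (fibSum 2 ε)) (fromℕ-+ d (fibSum 1 ε)) ⟩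
  invSqrt5 *₅ ((fromℕ 1 ℚ.+ N) ·β+ (fromℕ d ℚ.+ M)) -₅ δ₀
    ≡⟨ cong (λ x → invSqrt5 *₅ x -₅ δ₀) (·β+-+ (fromℕ 1) (fromℕ d) N M) ⟩
  invSqrt5 *₅ ((fromℕ 1 ·β+ fromℕ d) +₅ (N ·β+ M)) -₅ δ₀
    ≡⟨ cong (_-₅ δ₀) (*₅-distribˡ-+₅ invSqrt5 (fromℕ 1 ·β+ fromℕ d) (N ·β+ M)) ⟩
  invSqrt5 *₅ (fromℕ 1 ·β+ fromℕ d) +₅ δ₀ -₅ δ₀
    ≡⟨ x+₅y-₅y≡x _ δ₀ ⟩
  invSqrt5 *₅ (fromℕ 1 ·β+ fromℕ d) ∎
  where
  open ≡-Reasoning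
  N M : ℚ
  N = fromℕ (fibSum 2 ε)
  M = fromℕ (fibSum 1 ε)
  δ₀ : Q5
  δ₀ = invSqrt5 *₅ (N ·β+ M)

increment : (n : ℕ) (ε ε′ : List Bool) → IsZeck ε n → IsZeck ε′ (suc n) →
  (lastDigit ε ≡ false → δ ε′ -₅ δ ε ≡ invSqrt5 *₅ (β ^₅ 2))
  × (lastDigit ε ≡ true → δ ε′ -₅ δ ε ≡ invSqrt5 *₅ β)
increment n ε ε′ z z′ =
    (λ e → δ-increment ε ε′ 1 z z′ (isFloor/β-unique floor′ (isFloor/β-succ-last0 ε e)))
  , (λ e → δ-increment ε ε′ 0 z z′ (isFloor/β-unique floor′ (isFloor/β-succ-last1 ε (proj₂ z) e)))
  where
  floor′ : IsFloor/β (2 + fibSum 2 ε) (fibSum 1 ε′)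
  floor′ = subst (λ x → IsFloor/β (suc x) (fibSum 1 ε′)) (fibSum-succ ε ε′ z z′) (isFloor/β-fibSum ε′)

invSqrt5*β²-positive : Pos₅ (invSqrt5 *₅ (β ^₅ 2))
invSqrt5*β²-positive = inj₁ (toWitness {a? = 0ℚ ℚ.≤? _} _ , toWitness {a? = 0ℚ ℚ.≤? _} _ , λ { (() , _) })

invSqrt5*β-positive : Pos₅ (invSqrt5 *₅ β)
invSqrt5*β-positive = inj₁ (toWitness {a? = 0ℚ ℚ.≤? _} _ , toWitness {a? = 0ℚ ℚ.≤? _} _ , λ { (() , _) })

increasing : (n : ℕ) (ε ε′ : List Bool) → IsZeck ε n → IsZeck ε′ (suc n) → δ ε <₅ δ ε′
increasing n ε ε′ z z′ with lastDigit ε in e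
... | false = subst Pos₅ (sym (proj₁ (increment n ε ε′ z z′) e)) invSqrt5*β²-positive
... | true = subst Pos₅ (sym (proj₂ (increment n ε ε′ z z′) e)) invSqrt5*β-positive

0<fib[1+n] : ∀ n → 0 < fib (suc n)
0<fib[1+n] zero = s≤s z≤n
0<fib[1+n] (suc n) = <-≤-trans (0<fib[1+n] n) (m≤m+n (fib (suc n)) (fib n))

n≤fib[2+n] : ∀ n → n ≤ fib (2 + n)
n≤fib[2+n] zero = z≤n
n≤fib[2+n] (suc n) = ≤-<-trans (n≤fib[2+n] n) (m<m+n (fib (2 + n)) (0<fib[1+n] n))

oneAt : ℕ → List Bool
oneAt zero = true ∷ []
oneAt (suc k) = false ∷ oneAt k

oneAt-noAdj : ∀ k → NoAdj (oneAt k)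
oneAt-noAdj zero = tt
oneAt-noAdj (suc zero) = tt
oneAt-noAdj (suc (suc k)) = oneAt-noAdj (suc k)

fibSum-oneAt : ∀ j k → fibSum j (oneAt k) ≡ fib (j + k)
fibSum-oneAt j zero = trans (+-identityʳ (fib j)) (cong fib (sym (+-identityʳ j)))
fibSum-oneAt j (suc k) = trans (fibSum-oneAt (suc j) k) (cong fib (sym (+-suc j k)))

p<q⇒0<q-p : ∀ {p q} → p ℚ.< q → 0ℚ ℚ.< q ℚ.- p
p<q⇒0<q-p {p} {q} p<q = subst (ℚ._< q ℚ.- p) (ℚ.+-inverseʳ p) (ℚ.+-monoˡ-< (ℚ.- p) p<q)

<₅-componentwise : ∀ {p q p′ q′} → p ℚ.< p′ → q ℚ.< q′ → (p , q) <₅ (p′ , q′)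
<₅-componentwise p<p′ q<q′ = inj₁
  ( ℚ.<⇒≤ (p<q⇒0<q-p p<p′)
  , ℚ.<⇒≤ (p<q⇒0<q-p q<q′)
  , λ (p′-p≡0 , _) → ℚ.<-irrefl (sym p′-p≡0) (p<q⇒0<q-p p<p′))

<₅-invSqrt5*·β+ : ∀ p q x y → 0ℚ ℚ.≤ y → (p ℚ.+ p) ⊔ (q ℚ.* (+ 10 / 1)) ℚ.< x →
  (p , q) <₅ invSqrt5 *₅ (x ·β+ y)
<₅-invSqrt5*·β+ p q x y 0≤y r<x =
  subst ((p , q) <₅_) (sym invSqrt5*·β+≡) (<₅-componentwise p<x/2 q<[y+x/2]/5)
  where
  open ℚ-Solver
  open ℚ.≤-Reasoning
  invSqrt5*·β+≡ : invSqrt5 *₅ (x ·β+ y) ≡ (x ℚ.* ½ , (y ℚ.+ x ℚ.* ½) ℚ.* (+ 1 / 5))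
  invSqrt5*·β+≡ = cong₂ _,_
    (solve 2 (λ x y → con 0ℚ :* (y :+ x :* con ½) :+ con (+ 5 / 1) :* (con (+ 1 / 5) :* (x :* con ½))
      := x :* con ½) refl x y)
    (solve 2 (λ x y → con 0ℚ :* (x :* con ½) :+ con (+ 1 / 5) :* (y :+ x :* con ½)
      := (y :+ x :* con ½) :* con (+ 1 / 5)) refl x y)
  p<x/2 : p ℚ.< x ℚ.* ½
  p<x/2 = begin-strict
    p                  ≡⟨ solve 1 (λ p → p := (p :+ p) :* con ½) refl p ⟩
    (p ℚ.+ p) ℚ.* ½    <⟨ ℚ.*-monoˡ-<-pos ½ (ℚ.≤-<-trans (ℚ.p≤p⊔q (p ℚ.+ p) (q ℚ.* (+ 10 / 1))) r<x) ⟩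
    x ℚ.* ½            ∎
  q<[y+x/2]/5 : q ℚ.< (y ℚ.+ x ℚ.* ½) ℚ.* (+ 1 / 5)
  q<[y+x/2]/5 = begin-strict
    q   ≡⟨ solve 1 (λ q → q := (con 0ℚ :+ (q :* con (+ 10 / 1)) :* con ½) :* con (+ 1 / 5)) refl q ⟩
    (0ℚ ℚ.+ (q ℚ.* (+ 10 / 1)) ℚ.* ½) ℚ.* (+ 1 / 5)
        <⟨ ℚ.*-monoˡ-<-pos (+ 1 / 5) (ℚ.+-mono-≤-< 0≤y
             (ℚ.*-monoˡ-<-pos ½ (ℚ.≤-<-trans (ℚ.p≤q⊔p (p ℚ.+ p) (q ℚ.* (+ 10 / 1))) r<x))) ⟩
    (y ℚ.+ x ℚ.* ½) ℚ.* (+ 1 / 5) ∎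

unbounded : (M : Q5) → ∃[ n ] ∃[ ε ] (IsZeck ε n × M <₅ δ ε)
unbounded (p , q) with archimedean ((p ℚ.+ p) ⊔ (q ℚ.* (+ 10 / 1)))
... | k , r<k = zval (oneAt k) , oneAt k , (refl , oneAt-noAdj k) ,
  subst ((p , q) <₅_) (sym (δ≡fibSum (oneAt k)))
    (<₅-invSqrt5*·β+ p q _ _ (fromℕ-mono-≤ z≤n) (ℚ.<-≤-trans r<k (fromℕ-mono-≤ k≤N)))
  where
  k≤N : k ≤ fibSum 2 (oneAt k)
  k≤N = subst (k ≤_) (sym (fibSum-oneAt 2 k)) (n≤fib[2+n] k)

proposition1 : ((n : ℕ) (ε ε′ : List Bool) → IsZeck ε n → IsZeck ε′ (suc n) →
      (lastDigit ε ≡ false → δ ε′ -₅ δ ε ≡ invSqrt5 *₅ (β ^₅ 2))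
      × (lastDigit ε ≡ true → δ ε′ -₅ δ ε ≡ invSqrt5 *₅ β))
    × ((n : ℕ) (ε ε′ : List Bool) → IsZeck ε n → IsZeck ε′ (suc n) → δ ε <₅ δ ε′)
    × ((M : Q5) → ∃[ n ] ∃[ ε ] (IsZeck ε n × M <₅ δ ε))
proposition1 = increment , increasing , unbounded
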